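{- Let $F$ be a finite forest with exactly one cherry $(c,\ell_1,\ell_2)$. Then $o(F)=\mathcal{A}$ if and only if there is a matching in $F\setminus\{c\}$ that covers every vertex of $V(F)\setminus N[c]$.
   Context: Maker-Maker domination game on a finite simple graph $G$: Alice and Bob alternately claim previously unclaimed vertices, Alice first; the first player whose claimed vertices form a dominating set of $G$ wins; if all vertices are claimed and nobody dominates, it is a draw. $o(G)=\mathcal{A}$ if Alice has a winning strategy and $o(G)=\mathcal{D}$ otherwise. $N[c]$ is the closed neighbourhood of $c$. A leaf is a vertex of degree 1. A cherry is a triple $(c,\ell_1,\ell_2)$ where $\ell_1\ne\ell_2$ are leaves both adjacent to the vertex $c$. -}

module Defs where

open import Data.Nat using (ℕ; zero; suc; _≤_)
open import Data.Nat.Base using () renaming (_+_ to _+ℕ_)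
open import Data.Bool using (Bool; true; false; if_then_else_)
open import Data.Fin using (Fin; _≟_)
open import Data.List using (List; []; _∷_; _++_; length; map; allFin; concatMap)
open import Data.Nat.ListAction using (sum)
open import Data.Unit using (⊤)
open import Data.List.Relation.Unary.Unique.Propositional using (Unique)
open import Data.List.Relation.Unary.Linked using (Linked)
open import Data.List.Membership.Propositional using (_∈_)
open import Data.Product using (Σ; ∃; _×_; _,_)
open import Data.Sum using (_⊎_)
open import Data.Empty using (⊥)
open import Relation.Nullary using (¬_; does)
open import Relation.Binary.PropositionalEquality using (_≡_; _≢_)

record SimpleGraph (n : ℕ) : Set where
  field
    adj    : Fin n → Fin n → Bool
    sym    : ∀ u v → adj u v ≡ adj v u
    irrefl : ∀ v → adj v v ≡ false

open SimpleGraph public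

module _ {n : ℕ} (G : SimpleGraph n) where

  Adj : Fin n → Fin n → Set
  Adj u v = adj G u v ≡ true

  degree : Fin n → ℕ
  degree v = sum (map (λ w → if adj G v w then 1 else 0) (allFin n))

  IsLeaf : Fin n → Set
  IsLeaf v = degree v ≡ 1

  InClosedNbhd : Fin n → Fin n → Set
  InClosedNbhd c w = c ≡ w ⊎ Adj c w

  IsCycle : List (Fin n) → Set
  IsCycle [] = ⊥
  IsCycle (v ∷ xs) = (3 ≤ length (v ∷ xs)) × Unique (v ∷ xs) × Linked Adj (v ∷ xs ++ v ∷ [])

  IsForest : Set
  IsForest = ∀ xs → ¬ IsCycle xs

  IsCherry : Fin n → Fin n → Fin n → Set
  IsCherry c l₁ l₂ = l₁ ≢ l₂ × IsLeaf l₁ × IsLeaf l₂ × Adj c l₁ × Adj c l₂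

  -- exactly one cherry (cherries (c,l₁,l₂) and (c,l₂,l₁) are the same cherry)
  HasUniqueCherry : Fin n → Fin n → Fin n → Set
  HasUniqueCherry c l₁ l₂ =
    IsCherry c l₁ l₂ ×
    (∀ c' a b → IsCherry c' a b → c' ≡ c × ((a ≡ l₁ × b ≡ l₂) ⊎ (a ≡ l₂ × b ≡ l₁)))

  endpoints : List (Fin n × Fin n) → List (Fin n)
  endpoints = concatMap (λ { (u , v) → u ∷ v ∷ [] })

  AllEdges : List (Fin n × Fin n) → Set
  AllEdges [] = ⊤
  AllEdges ((u , v) ∷ es) = Adj u v × AllEdges es

  IsMatching : List (Fin n × Fin n) → Set
  IsMatching M = AllEdges M × Unique (endpoints M)

  -- A matching of the graph G ∖ {c}: a matching of G none of whose endpoints is c.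
  IsMatchingMinus : Fin n → List (Fin n × Fin n) → Set
  IsMatchingMinus c M = IsMatching M × ¬ (c ∈ endpoints M)

  CoversOutsideClosedNbhd : Fin n → List (Fin n × Fin n) → Set
  CoversOutsideClosedNbhd c M = ∀ w → ¬ InClosedNbhd c w → w ∈ endpoints M

  data Player : Set where
    alice bob : Player

  data Owner : Set where
    free : Owner
    own  : Player → Owner

  Position : Set
  Position = Fin n → Owner

  start : Position
  start _ = free

  claim : Position → Fin n → Player → Position
  claim pos v p w = if does (w ≟ v) then own p else pos w

  Dominates : Position → Player → Set
  Dominates pos p = ∀ v → ∃ λ u → pos u ≡ own p × (u ≡ v ⊎ Adj u v)

  -- AliceWinsFrom pos : Alice to move in pos, Alice has a winning strategy.
  -- AliceWinsAfter pos : Bob to move in pos, Alice has a winning strategy.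
  data AliceWinsFrom (pos : Position) : Set
  data AliceWinsAfter (pos : Position) : Set

  data AliceWinsFrom pos where
    winNow : ∀ v → pos v ≡ free → Dominates (claim pos v alice) alice → AliceWinsFrom pos
    moveOn : ∀ v → pos v ≡ free → AliceWinsAfter (claim pos v alice) → AliceWinsFrom pos

  data AliceWinsAfter pos where
    bobMoves : (∃ λ w → pos w ≡ free) →
               (∀ w → pos w ≡ free →
                  ¬ Dominates (claim pos w bob) bob × AliceWinsFrom (claim pos w bob)) →
               AliceWinsAfter pos

  AliceWins : Set
  AliceWins = AliceWinsFrom start

-- If F ∖ {c} has a matching M covering V(F) ∖ N[c], Alice opens with c and plays a pairing
-- strategy: the two leaves of the cherry form one pair, the ends of each edge of M another,
-- and she answers every move of Bob with the other vertex of its pair. Then c dominates N[c],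
-- every vertex covered by M is dominated from its pair, and Bob never owns both leaves, which
-- he would need in order to dominate them.
--
-- Conversely, suppose Alice wins. If she does not open with c, Bob takes c, and she must then
-- own both leaves before Bob takes one; so she opened with one leaf and now takes the other.
-- From there we follow her winning strategy against a greedy Bob: while some vertex t not
-- dominated by Alice has at most one free neighbour y, Bob takes y (or t if there is none),
-- Alice is forced to answer with t, and the edge ty joins the matching. Throughout, vertices
-- not dominated by Alice stay free and no free path joins two free vertices dominated by
-- Alice (after opening with c such a path would close a cycle through c). So if every
-- undominated vertex had two free neighbours, a free path grown from one of them in both
-- directions would, the graph being a forest, end at two such vertices: a contradiction.
module Submission where

open import Defs
open import Data.Bool using (true; if_then_else_)
import Data.Bool.Properties as Bool
open import Data.Empty using (⊥; ⊥-elim)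
open import Data.Fin using (Fin; zero; suc; _≟_)
open import Data.Fin.Properties using (pigeonhole; any?; all?) renaming (<⇒≢ to <⇒≢ᶠ)
open import Data.List using (List; []; _∷_; _++_; _∷ʳ_; length; map; reverse; lookup; allFin)
open import Data.List.Properties using (++-assoc; ∷ʳ-++; unfold-reverse; reverse-++; length-++-≤ʳ)
open import Data.List.Membership.Propositional using (_∈_; _∉_)
open import Data.List.Membership.Propositional.Properties using (∈-lookup; ∈-allFin; ∈-∃++)
import Data.List.Membership.DecPropositional as DecMembership
open import Data.List.Relation.Unary.All as All using (All; []; _∷_)
open import Data.List.Relation.Unary.All.Properties using (¬Any⇒All¬; ++⁻ˡ; ++⁻ʳ)
open import Data.List.Relation.Unary.AllPairs using (AllPairs; []; _∷_)
open import Data.List.Relation.Unary.Any using (here; there)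
open import Data.List.Relation.Unary.Linked using (Linked; []; [-]; _∷_)
open import Data.List.Relation.Unary.Unique.Propositional using (Unique)
import Data.List.Relation.Binary.Permutation.Setoid as Permutation
import Data.List.Relation.Binary.Permutation.Setoid.Properties as PermutationProperties
open import Data.Nat using (ℕ; zero; suc; _+_; _≤_; _<_; z≤n; s≤s)
open import Data.Nat.ListAction using (sum)
open import Data.Nat.Properties
  using (≤-refl; ≤-trans; ≤-pred; <-trans; <-≤-trans; <⇒≱; ≰⇒>; _≤?_; m≤m+n; m≤n+m; +-suc; +-identityʳ;
         +-mono-≤; +-mono-<-≤; +-mono-≤-<)
open import Data.Product using (∃; ∃₂; _×_; _,_; proj₁; proj₂)
open import Data.Product.Properties using (≡-dec)
open import Data.Sum using (_⊎_; inj₁; inj₂)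
import Data.Sum as Sum
open import Data.Unit using (tt)
open import Function using (_∘_; case_of_)
open import Function.Bundles using (_⇔_; mk⇔)
open import Level using (0ℓ)
open import Relation.Binary.Core using (Rel)
open import Relation.Binary.Definitions using (Symmetric)
open import Relation.Binary.PropositionalEquality as ≡ using (_≡_; _≢_; ≢-sym; refl; cong; subst)
open import Relation.Nullary using (¬_; Dec; yes; no; ¬?)
open import Relation.Nullary.Decidable using (_×-dec_; _⊎-dec_; map′; decidable-stable)
open import Relation.Unary using (Pred; Decidable)

module _ {A : Set} where

  module _ {R : Rel A 0ℓ} where

    AllPairs-++⁻ˡ : ∀ xs {ys} → AllPairs R (xs ++ ys) → AllPairs R xs
    AllPairs-++⁻ˡ []       _          = []
    AllPairs-++⁻ˡ (x ∷ xs) (px ∷ pxs) = ++⁻ˡ xs px ∷ AllPairs-++⁻ˡ xs pxs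

    Linked-++⁻ˡ : ∀ xs {ys} → Linked R (xs ++ ys) → Linked R xs
    Linked-++⁻ˡ []           _        = []
    Linked-++⁻ˡ (x ∷ [])     _        = [-]
    Linked-++⁻ˡ (x ∷ y ∷ xs) (r ∷ rs) = r ∷ Linked-++⁻ˡ (y ∷ xs) rs

    Linked-∷ʳ : ∀ xs {y z} → Linked R (xs ∷ʳ y) → R y z → Linked R (xs ∷ʳ y ∷ʳ z)
    Linked-∷ʳ []           _         r = r ∷ [-]
    Linked-∷ʳ (x ∷ [])     (r′ ∷ _)  r = r′ ∷ r ∷ [-]
    Linked-∷ʳ (x ∷ y ∷ xs) (r′ ∷ rs) r = r′ ∷ Linked-∷ʳ (y ∷ xs) rs r

    module _ (sym : Symmetric R) where

      Linked-reverse-∷ : ∀ {x xs} → Linked R (x ∷ xs) → Linked R (reverse xs ∷ʳ x)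
      Linked-reverse-∷ [-] = [-]
      Linked-reverse-∷ {x} {y ∷ xs} (r ∷ rs) rewrite unfold-reverse y xs =
        Linked-∷ʳ (reverse xs) (Linked-reverse-∷ rs) (sym r)

      Linked-reverse : ∀ {xs} → Linked R xs → Linked R (reverse xs)
      Linked-reverse {[]}     _  = []
      Linked-reverse {x ∷ xs} rs rewrite unfold-reverse x xs = Linked-reverse-∷ rs

  open Permutation (≡.setoid A) using (↭-sym)
  open PermutationProperties (≡.setoid A) using (Unique-resp-↭; All-resp-↭; ↭-reverse)

  Unique-reverse : ∀ {xs : List A} → Unique xs → Unique (reverse xs)
  Unique-reverse {xs} = Unique-resp-↭ (↭-sym (↭-reverse xs))

  All-reverse : ∀ {P : A → Set} {xs} → All P xs → All P (reverse xs)
  All-reverse {P} {xs} = All-resp-↭ (subst P) (↭-sym (↭-reverse xs))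

  reverse-∷-++ : ∀ (a : A) xs t → reverse (a ∷ xs ++ t ∷ []) ≡ t ∷ reverse xs ++ a ∷ []
  reverse-∷-++ a xs t = begin
    reverse (a ∷ xs ++ t ∷ [])   ≡⟨ unfold-reverse a (xs ++ t ∷ []) ⟩
    reverse (xs ++ t ∷ []) ∷ʳ a  ≡⟨ cong (_∷ʳ a) (reverse-++ xs (t ∷ [])) ⟩
    t ∷ reverse xs ++ a ∷ []     ∎
    where open ≡.≡-Reasoning

  Unique-lookup-injective : ∀ {xs : List A} → Unique xs → ∀ i j → lookup xs i ≡ lookup xs j → i ≡ j
  Unique-lookup-injective {x ∷ xs} _         zero    zero    _ = refl
  Unique-lookup-injective {x ∷ xs} (px ∷ _)  zero    (suc j) e = ⊥-elim (All.lookup px (∈-lookup j) e)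
  Unique-lookup-injective {x ∷ xs} (px ∷ _)  (suc i) zero    e = ⊥-elim (All.lookup px (∈-lookup i) (≡.sym e))
  Unique-lookup-injective {x ∷ xs} (_ ∷ pxs) (suc i) (suc j) e = cong suc (Unique-lookup-injective pxs i j e)

  module _ (f : A → ℕ) where

    ≤-sum-map : ∀ {a xs} → a ∈ xs → f a ≤ sum (map f xs)
    ≤-sum-map {xs = x ∷ xs} (here refl) = m≤m+n (f x) _
    ≤-sum-map {xs = x ∷ xs} (there a∈)  = ≤-trans (≤-sum-map a∈) (m≤n+m _ (f x))

    2≤-sum-map : ∀ {a b xs} → a ∈ xs → b ∈ xs → a ≢ b → 1 ≤ f a → 1 ≤ f b → 2 ≤ sum (map f xs)
    2≤-sum-map (here refl) (here refl) a≢b _ _ = ⊥-elim (a≢b refl)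
    2≤-sum-map (here refl) (there b∈) _ fa fb = +-mono-≤ fa (≤-trans fb (≤-sum-map b∈))
    2≤-sum-map (there a∈) (here refl) _ fa fb = +-mono-≤ fb (≤-trans fa (≤-sum-map a∈))
    2≤-sum-map {xs = x ∷ _} (there a∈) (there b∈) a≢b fa fb =
      ≤-trans (2≤-sum-map a∈ b∈ a≢b fa fb) (m≤n+m _ (f x))

  module _ (f g : A → ℕ) (f≤g : ∀ x → f x ≤ g x) where

    sum-map-mono-≤ : ∀ xs → sum (map f xs) ≤ sum (map g xs)
    sum-map-mono-≤ []       = z≤n
    sum-map-mono-≤ (x ∷ xs) = +-mono-≤ (f≤g x) (sum-map-mono-≤ xs)

    sum-map-mono-< : ∀ {a xs} → a ∈ xs → f a < g a → sum (map f xs) < sum (map g xs)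
    sum-map-mono-< {xs = x ∷ xs} (here refl) fa<ga = +-mono-<-≤ fa<ga (sum-map-mono-≤ xs)
    sum-map-mono-< {xs = x ∷ xs} (there a∈)  fa<ga = +-mono-≤-< (f≤g x) (sum-map-mono-< a∈ fa<ga)

Unique⇒length≤ : ∀ {n} {xs : List (Fin n)} → Unique xs → length xs ≤ n
Unique⇒length≤ {n} {xs} u with length xs ≤? n
... | yes ≤n = ≤n
... | no  ≰n with i , j , i<j , eq ← pigeonhole (≰⇒> ≰n) (lookup xs) =
  ⊥-elim (<⇒≢ᶠ i<j (Unique-lookup-injective u i j eq))

module Graph {n : ℕ} (G : SimpleGraph n) where

  Adj-sym : Symmetric (Adj G)
  Adj-sym {u} {v} = ≡.trans (SimpleGraph.sym G v u)

  Adj⇒≢ : ∀ {u v} → Adj G u v → u ≢ v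
  Adj⇒≢ {u} uu refl with () ← ≡.trans (≡.sym (SimpleGraph.irrefl G u)) uu

  Adj? : ∀ u v → Dec (Adj G u v)
  Adj? u v = adj G u v Bool.≟ true

  InClosedNbhd-sym : ∀ {u w} → InClosedNbhd G u w → InClosedNbhd G w u
  InClosedNbhd-sym (inj₁ refl) = inj₁ refl
  InClosedNbhd-sym (inj₂ uw)   = inj₂ (Adj-sym uw)

  2≤degree : ∀ {l a b} → a ≢ b → Adj G l a → Adj G l b → 2 ≤ degree G l
  2≤degree {l} {a} {b} a≢b la lb = 2≤-sum-map indicator (∈-allFin a) (∈-allFin b) a≢b (one la) (one lb)
    where
    indicator : Fin n → ℕ
    indicator w = if adj G l w then 1 else 0
    one : ∀ {w} → Adj G l w → 1 ≤ indicator w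
    one lw rewrite lw = s≤s z≤n

  leaf-neighbour-unique : ∀ {l a b} → IsLeaf G l → Adj G l a → Adj G l b → a ≡ b
  leaf-neighbour-unique {a = a} {b} leaf la lb with a ≟ b
  ... | yes a≡b = a≡b
  ... | no  a≢b with s≤s () ← subst (2 ≤_) leaf (2≤degree a≢b la lb)

  Path : Pred (Fin n) 0ℓ → List (Fin n) → Set
  Path P xs = Unique xs × Linked (Adj G) xs × All P xs

  Path-reverse : ∀ {P xs} → Path P xs → Path P (reverse xs)
  Path-reverse (u , l , ps) = Unique-reverse u , Linked-reverse Adj-sym l , All-reverse ps

  Path-∷ : ∀ {P h r z} → Path P (h ∷ r) → Adj G h z → P z → z ∉ r → Path P (z ∷ h ∷ r)
  Path-∷ (u , l , ps) hz Pz z∉r =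
    ¬Any⇒All¬ _ (λ { (here z≡h) → Adj⇒≢ hz (≡.sym z≡h) ; (there z∈r) → z∉r z∈r }) ∷ u ,
    Adj-sym hz ∷ l , Pz ∷ ps

  module Forest (forest : IsForest G) where

    path-ends-nonadjacent : ∀ {a b z} xs → Unique (a ∷ b ∷ xs ++ z ∷ []) →
                            Linked (Adj G) (a ∷ b ∷ xs ++ z ∷ []) → ¬ Adj G z a
    path-ends-nonadjacent {a} {b} {z} xs u l za =
      forest (a ∷ b ∷ xs ++ z ∷ []) (s≤s (s≤s (length-++-≤ʳ (z ∷ []) {xs})) , u , Linked-∷ʳ (a ∷ b ∷ xs) l za)

    no-chord : ∀ {P h q r z} → Path P (h ∷ q ∷ r) → Adj G h z → z ∉ r
    no-chord {h = h} {q} {z = z} (u , l , _) hz z∈r with pre , post , refl ← ∈-∃++ z∈r =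
      path-ends-nonadjacent pre (AllPairs-++⁻ˡ _ (subst Unique split u))
        (Linked-++⁻ˡ _ (subst (Linked (Adj G)) split l)) (Adj-sym hz)
      where
      split : h ∷ q ∷ pre ++ z ∷ post ≡ (h ∷ q ∷ pre) ∷ʳ z ++ post
      split = ≡.sym (∷ʳ-++ (h ∷ q ∷ pre) z post)

    fresh-neighbour : ∀ {P h r y y′} → Path P (h ∷ r) → y ≢ y′ → Adj G h y → P y → Adj G h y′ → P y′ →
                      ∃ λ z → Path P (z ∷ h ∷ r)
    fresh-neighbour {r = []} path _ hy Py _ _ = _ , Path-∷ path hy Py λ ()
    fresh-neighbour {r = q ∷ r} {y} path y≢y′ hy Py hy′ Py′ with y ≟ q
    ... | yes refl = _ , Path-∷ path hy′ Py′ λ where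
                           (here y′≡y)  → y≢y′ (≡.sym y′≡y)
                           (there y′∈r) → no-chord path hy′ y′∈r
    ... | no  y≢q  = _ , Path-∷ path hy Py λ where
                           (here y≡q)  → y≢q y≡q
                           (there y∈r) → no-chord path hy y∈r

    module Branching (P S : Pred (Fin n) 0ℓ) (S? : Decidable S)
      (branching : ∀ {v} → P v → ¬ S v → ∃₂ λ y y′ → y ≢ y′ × (Adj G v y × P y) × (Adj G v y′ × P y′))
      where

      extend : ∀ k {h r} → n < length (h ∷ r) + k → Path P (h ∷ r) → ∃₂ λ b zs → S b × Path P (b ∷ zs ++ r)
      extend zero n<len (u , _) = ⊥-elim (<⇒≱ (subst (n <_) (+-identityʳ _) n<len) (Unique⇒length≤ u))
      extend (suc k) {h} {r} n<len path@(_ , _ , Ph ∷ _) with S? h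
      ... | yes Sh = h , [] , Sh , path
      ... | no ¬Sh
        with y , y′ , y≢y′ , (hy , Py) , (hy′ , Py′) ← branching Ph ¬Sh
        with z , path′ ← fresh-neighbour path y≢y′ hy Py hy′ Py′
        with b , zs , Sb , path″ ← extend k (subst (n <_) (+-suc (length (h ∷ r)) k) n<len) path′
        = b , zs ++ h ∷ [] , Sb , subst (λ xs → Path P (b ∷ xs)) (≡.sym (++-assoc zs (h ∷ []) r)) path″

      extend-until : ∀ {h r} → Path P (h ∷ r) → ∃₂ λ b zs → S b × Path P (b ∷ zs ++ r)
      extend-until {r = r} = extend n (s≤s (m≤n+m n (length r)))

      path-between : ∀ {t} → P t → ¬ S t → ∃₂ λ a b → ∃ λ xs → S a × S b × Path P (b ∷ xs ++ a ∷ [])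
      path-between {t} Pt ¬St
        with y , _ , _ , (ty , Py) , _ ← branching Pt ¬St
        with a , zs , Sa , a⋯t ← extend-until (Path-∷ ([] ∷ [] , [-] , Pt ∷ []) ty Py λ ())
        with b , ys , Sb , b⋯a ← extend-until (subst (Path P) (reverse-∷-++ a zs t) (Path-reverse a⋯t))
        = a , b , ys ++ reverse zs , Sa , Sb ,
          subst (λ xs → Path P (b ∷ xs)) (≡.sym (++-assoc ys (reverse zs) (a ∷ []))) b⋯a

module Game {n : ℕ} (G : SimpleGraph n) where
  open Graph G

  Pos : Set
  Pos = Position G

  _≟ₚ_ : (p q : Player G) → Dec (p ≡ q)
  alice ≟ₚ alice = yes refl
  alice ≟ₚ bob   = no λ ()
  bob   ≟ₚ alice = no λ ()
  bob   ≟ₚ bob   = yes refl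

  _≟ₒ_ : (o o′ : Owner G) → Dec (o ≡ o′)
  free  ≟ₒ free  = yes refl
  free  ≟ₒ own _ = no λ ()
  own _ ≟ₒ free  = no λ ()
  own p ≟ₒ own q = map′ (cong own) (λ { refl → refl }) (p ≟ₚ q)

  owned-by-bob : ∀ {o : Owner G} → o ≢ free → o ≢ own alice → o ≡ own bob
  owned-by-bob {free}      o≢free _ = ⊥-elim (o≢free refl)
  owned-by-bob {own alice} _ o≢alice = ⊥-elim (o≢alice refl)
  owned-by-bob {own bob}   _ _ = refl

  Free : Pos → Fin n → Set
  Free pos w = pos w ≡ free

  Free? : ∀ pos w → Dec (Free pos w)
  Free? pos w = pos w ≟ₒ free

  claim-≡ : ∀ pos v p → claim G pos v p v ≡ own p
  claim-≡ pos v p with v ≟ v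
  ... | yes _   = refl
  ... | no  v≢v = ⊥-elim (v≢v refl)

  claim-≢ : ∀ pos v p {w} → w ≢ v → claim G pos v p w ≡ pos w
  claim-≢ pos v p {w} w≢v with w ≟ v
  ... | yes w≡v = ⊥-elim (w≢v w≡v)
  ... | no  _   = refl

  claim-cases : ∀ pos v p {w o} → claim G pos v p w ≡ o → (w ≡ v × own p ≡ o) ⊎ pos w ≡ o
  claim-cases pos v p {w} eq with w ≟ v
  ... | yes w≡v = inj₁ (w≡v , eq)
  ... | no  _   = inj₂ eq

  claimed-¬free : ∀ pos v p → ¬ Free (claim G pos v p) v
  claimed-¬free pos v p v-free with () ← ≡.trans (≡.sym (claim-≡ pos v p)) v-free

  claim-free⁻ : ∀ pos v p {w} → Free (claim G pos v p) w → Free pos w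
  claim-free⁻ pos v p w-free with claim-cases pos v p w-free
  ... | inj₁ (_ , ())
  ... | inj₂ w-free′ = w-free′

  claim-free⁺ : ∀ pos v p {w} → w ≢ v → Free pos w → Free (claim G pos v p) w
  claim-free⁺ pos v p w≢v = ≡.trans (claim-≢ pos v p w≢v)

  claim-owned : ∀ {pos v p q} u → Free pos v → pos u ≡ own q → claim G pos v p u ≡ own q
  claim-owned {pos} {v} {p} u v-free owned = ≡.trans (claim-≢ pos v p u≢v) owned
    where
    u≢v : u ≢ v
    u≢v refl with () ← ≡.trans (≡.sym owned) v-free

  ¬Free⇒All≢ : ∀ {pos v xs} → ¬ Free pos v → All (Free pos) xs → All (v ≢_) xs
  ¬Free⇒All≢ ¬free = All.map λ { w-free refl → ¬free w-free }

  Dominated : Pos → Player G → Fin n → Set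
  Dominated pos p w = ∃ λ u → pos u ≡ own p × InClosedNbhd G u w

  Dominated? : ∀ pos p w → Dec (Dominated pos p w)
  Dominated? pos p w = any? λ u → (pos u ≟ₒ own p) ×-dec ((u ≟ w) ⊎-dec Adj? u w)

  Dominated-claim⁺ : ∀ {pos v p q w} → Free pos v → Dominated pos q w → Dominated (claim G pos v p) q w
  Dominated-claim⁺ v-free (u , owned , uw) = u , claim-owned u v-free owned , uw

  Dominated-claim⁻ : ∀ {pos v p q w} → Dominated (claim G pos v p) q w →
                     Dominated pos q w ⊎ (p ≡ q × InClosedNbhd G v w)
  Dominated-claim⁻ {pos} {v} {p} (u , owned , uw) with claim-cases pos v p owned
  ... | inj₁ (refl , refl) = inj₂ (refl , uw)
  ... | inj₂ owned′        = inj₁ (u , owned′ , uw)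

  AliceWinsBy : Pos → Fin n → Set
  AliceWinsBy pos x = Dominates G (claim G pos x alice) alice ⊎ AliceWinsAfter G (claim G pos x alice)

  alice-move : ∀ {pos} → AliceWinsFrom G pos → ∃ λ x → Free pos x × AliceWinsBy pos x
  alice-move (winNow x x-free dom) = x , x-free , inj₁ dom
  alice-move (moveOn x x-free win) = x , x-free , inj₂ win

  bob-move : ∀ {pos w} → AliceWinsAfter G pos → Free pos w → AliceWinsFrom G (claim G pos w bob)
  bob-move (bobMoves _ reply) w-free = proj₂ (reply _ w-free)

  Blocked : Pos → Fin n → Set
  Blocked pos t = ∀ u → InClosedNbhd G u t → pos u ≡ own bob

  Blocked-claim : ∀ {pos v p t} → Free pos v → Blocked pos t → Blocked (claim G pos v p) t
  Blocked-claim v-free blocked u ut = claim-owned u v-free (blocked u ut)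

  Blocked⇒¬Dominated : ∀ {pos t} → Blocked pos t → ¬ Dominated pos alice t
  Blocked⇒¬Dominated blocked (u , owned , ut) with () ← ≡.trans (≡.sym owned) (blocked u ut)

  Blocked⇒¬AliceWinsFrom  : ∀ {pos t} → Blocked pos t → ¬ AliceWinsFrom G pos
  Blocked⇒¬AliceWinsAfter : ∀ {pos t} → Blocked pos t → ¬ AliceWinsAfter G pos
  Blocked⇒¬AliceWinsFrom {t = t} blocked (winNow v v-free dom) =
    Blocked⇒¬Dominated (Blocked-claim v-free blocked) (dom t)
  Blocked⇒¬AliceWinsFrom blocked (moveOn v v-free win) =
    Blocked⇒¬AliceWinsAfter (Blocked-claim v-free blocked) win
  Blocked⇒¬AliceWinsAfter blocked (bobMoves (w , w-free) reply) =
    Blocked⇒¬AliceWinsFrom (Blocked-claim w-free blocked) (proj₂ (reply w w-free))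

  Guarded : Pos → Fin n → Set
  Guarded pos t = ∀ {u} → Adj G u t → pos u ≡ own bob

  Guarded-claim : ∀ {pos v p t} → Free pos v → Guarded pos t → Guarded (claim G pos v p) t
  Guarded-claim v-free guarded {u} ut = claim-owned u v-free (guarded ut)

  Guarded⇒Blocked : ∀ {pos t} → Guarded pos t → Blocked (claim G pos t bob) t
  Guarded⇒Blocked {pos} {t} guarded u (inj₁ refl) = claim-≡ pos t bob
  Guarded⇒Blocked {pos} {t} guarded u (inj₂ ut)   = ≡.trans (claim-≢ pos t bob (Adj⇒≢ ut)) (guarded ut)

  must-take-guarded : ∀ {pos t x} → Free pos t → Guarded pos t → Free pos x → x ≢ t → ¬ AliceWinsBy pos x
  must-take-guarded {pos} {t} {x} t-free guarded x-free x≢t = λ where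
      (inj₁ dom) → Blocked⇒¬Dominated blocked (Dominated-claim⁺ t-free′ (dom t))
      (inj₂ win) → Blocked⇒¬AliceWinsFrom blocked (bob-move win t-free′)
    where
    t-free′ : Free (claim G pos x alice) t
    t-free′ = claim-free⁺ pos x alice (λ t≡x → x≢t (≡.sym t≡x)) t-free
    blocked : Blocked (claim G (claim G pos x alice) t bob) t
    blocked = Guarded⇒Blocked (Guarded-claim x-free guarded)

  free-indicator : Owner G → ℕ
  free-indicator free    = 1
  free-indicator (own _) = 0

  freeCount : Pos → ℕ
  freeCount pos = sum (map (free-indicator ∘ pos) (allFin n))

  freeCount-claim : ∀ {pos v} p → Free pos v → freeCount (claim G pos v p) < freeCount pos
  freeCount-claim {pos} {v} p v-free =
    sum-map-mono-< (free-indicator ∘ claim G pos v p) (free-indicator ∘ pos) claim≤ (∈-allFin v) claim<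
    where
    claim≤ : ∀ w → free-indicator (claim G pos v p w) ≤ free-indicator (pos w)
    claim≤ w with w ≟ v
    ... | yes _ = z≤n
    ... | no  _ = ≤-refl
    claim< : free-indicator (claim G pos v p v) < free-indicator (pos v)
    claim< rewrite claim-≡ pos v p | v-free = s≤s z≤n

module Extraction {n : ℕ} (G : SimpleGraph n) (forest : IsForest G) where
  open Graph G
  open Forest forest
  open Game G

  record Invariant (pos : Pos) : Set where
    field
      undominated-free : ∀ {w} → ¬ Dominated pos alice w → Free pos w
      separated        : ∀ {a b} xs → Path (Free pos) (b ∷ xs ++ a ∷ []) →
                         Dominated pos alice a → Dominated pos alice b → ⊥

  CoveringFreeMatching : Pos → Set
  CoveringFreeMatching pos =
    ∃ λ M → IsMatching G M × All (Free pos) (endpoints G M) × (∀ w → ¬ Dominated pos alice w → w ∈ endpoints G M)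

  covering-[] : ∀ {pos} → (∀ w → ¬ ¬ Dominated pos alice w) → CoveringFreeMatching pos
  covering-[] dominated = [] , (tt , []) , [] , λ w ¬dom → ⊥-elim (dominated w ¬dom)

  FreeNeighbour : Pos → Fin n → Fin n → Set
  FreeNeighbour pos t y = Adj G t y × Free pos y

  FreeNeighbour? : ∀ pos t y → Dec (FreeNeighbour pos t y)
  FreeNeighbour? pos t y = Adj? t y ×-dec Free? pos y

  TwoFreeNeighbours : Pos → Fin n → Set
  TwoFreeNeighbours pos t = ∃₂ λ y y′ → y ≢ y′ × FreeNeighbour pos t y × FreeNeighbour pos t y′

  TwoFreeNeighbours? : ∀ pos t → Dec (TwoFreeNeighbours pos t)
  TwoFreeNeighbours? pos t =
    any? λ y → any? λ y′ → ¬? (y ≟ y′) ×-dec FreeNeighbour? pos t y ×-dec FreeNeighbour? pos t y′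

  some-undominated-vertex-has-few-free-neighbours :
    ∀ {pos t} → Invariant pos → ¬ Dominated pos alice t →
    ¬ (∀ {v} → ¬ Dominated pos alice v → TwoFreeNeighbours pos v)
  some-undominated-vertex-has-few-free-neighbours {pos} inv ¬dom branching
    with a , b , xs , dom-a , dom-b , path
           ← Branching.path-between (Free pos) (Dominated pos alice) (Dominated? pos alice) (λ _ → branching)
               (Invariant.undominated-free inv ¬dom) ¬dom =
    Invariant.separated inv xs path dom-a dom-b

  module Forcing {pos t y} (inv : Invariant pos) (¬dom-t : ¬ Dominated pos alice t)
                 (ty : Adj G t y) (y-free : Free pos y)
                 (only-y : ∀ {y′} → FreeNeighbour pos t y′ → y′ ≡ y) where
    open Invariant inv

    after-bob : Pos
    after-bob = claim G pos y bob

    after-alice : Pos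
    after-alice = claim G after-bob t alice

    t-free : Free pos t
    t-free = undominated-free ¬dom-t

    t-free′ : Free after-bob t
    t-free′ = claim-free⁺ pos y bob (Adj⇒≢ ty) t-free

    guarded : Guarded after-bob t
    guarded {u} ut with u ≟ y
    ... | yes refl = refl
    ... | no  u≢y  = owned-by-bob (λ u-free → u≢y (only-y (Adj-sym ut , u-free)))
                                  (λ u-alice → ¬dom-t (u , u-alice , inj₂ ut))

    ¬free-t : ¬ Free after-alice t
    ¬free-t = claimed-¬free after-bob t alice

    ¬free-y : ¬ Free after-alice y
    ¬free-y y-free′ = claimed-¬free pos y bob (claim-free⁻ after-bob t alice y-free′)

    free⁻ : ∀ {w} → Free after-alice w → Free pos w
    free⁻ w-free = claim-free⁻ pos y bob (claim-free⁻ after-bob t alice w-free)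

    free-near-t : ∀ {w} → Free pos w → InClosedNbhd G t w → w ≡ t ⊎ w ≡ y
    free-near-t _      (inj₁ refl) = inj₁ refl
    free-near-t w-free (inj₂ tw)   = inj₂ (only-y (tw , w-free))

    dominated⁻ : ∀ {w} → Dominated after-alice alice w → Dominated pos alice w ⊎ InClosedNbhd G t w
    dominated⁻ dom with Dominated-claim⁻ {after-bob} dom
    ... | inj₂ (_ , tw) = inj₂ tw
    ... | inj₁ dom′ with Dominated-claim⁻ {pos} dom′
    ...   | inj₁ dom″   = inj₁ dom″
    ...   | inj₂ (() , _)

    dominated-free⁻ : ∀ {w} → Free after-alice w → Dominated after-alice alice w → Dominated pos alice w
    dominated-free⁻ w-free dom with dominated⁻ dom
    ... | inj₁ dom′ = dom′
    ... | inj₂ tw with free-near-t (free⁻ w-free) tw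
    ...   | inj₁ refl = ⊥-elim (¬free-t w-free)
    ...   | inj₂ refl = ⊥-elim (¬free-y w-free)

    invariant : Invariant after-alice
    invariant = record { undominated-free = undominated-free′ ; separated = separated′ }
      where
      undominated-free′ : ∀ {w} → ¬ Dominated after-alice alice w → Free after-alice w
      undominated-free′ {w} ¬dom = claim-free⁺ after-bob t alice w≢t (claim-free⁺ pos y bob w≢y (undominated-free ¬dom-pos))
        where
        ¬dom-pos : ¬ Dominated pos alice w
        ¬dom-pos dom = ¬dom (Dominated-claim⁺ t-free′ (Dominated-claim⁺ y-free dom))
        w≢t : w ≢ t
        w≢t refl = ¬dom (t , claim-≡ after-bob t alice , inj₁ refl)
        w≢y : w ≢ y
        w≢y refl = ¬dom (t , claim-≡ after-bob t alice , inj₂ ty)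
      separated′ : ∀ {a b} xs → Path (Free after-alice) (b ∷ xs ++ a ∷ []) →
                   Dominated after-alice alice a → Dominated after-alice alice b → ⊥
      separated′ xs (u , l , frees@(b-free ∷ rest)) dom-a dom-b =
        separated xs (u , l , All.map free⁻ frees)
          (dominated-free⁻ (All.head (++⁻ʳ xs rest)) dom-a) (dominated-free⁻ b-free dom-b)

    extend-matching : CoveringFreeMatching after-alice → CoveringFreeMatching pos
    extend-matching (M , (edges , unique) , frees , covers) =
      (t , y) ∷ M , ((ty , edges) , unique′) , t-free ∷ y-free ∷ All.map free⁻ frees , covers′
      where
      unique′ : Unique (t ∷ y ∷ endpoints G M)
      unique′ = (Adj⇒≢ ty ∷ ¬Free⇒All≢ ¬free-t frees) ∷ ¬Free⇒All≢ ¬free-y frees ∷ unique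
      covers′ : ∀ w → ¬ Dominated pos alice w → w ∈ t ∷ y ∷ endpoints G M
      covers′ w ¬dom with Dominated? after-alice alice w
      ... | no ¬dom′ = there (there (covers w ¬dom′))
      ... | yes dom′ with dominated⁻ dom′
      ...   | inj₁ dom = ⊥-elim (¬dom dom)
      ...   | inj₂ tw with free-near-t (undominated-free ¬dom) tw
      ...     | inj₁ refl = here refl
      ...     | inj₂ refl = there (here refl)

  ¬two⇒unique-free-neighbour : ∀ {pos t y} → ¬ TwoFreeNeighbours pos t → FreeNeighbour pos t y →
                               ∀ {y′} → FreeNeighbour pos t y′ → y′ ≡ y
  ¬two⇒unique-free-neighbour {y = y} ¬two ty {y′} ty′ with y′ ≟ y
  ... | yes y′≡y = y′≡y
  ... | no  y′≢y = ⊥-elim (¬two (y′ , y , y′≢y , ty′ , ty))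

  extract : ∀ {pos} → Invariant pos → AliceWinsAfter G pos → CoveringFreeMatching pos
  extract {pos} inv win@(bobMoves _ reply) with any? (λ t → ¬? (Dominated? pos alice t))
  ... | no ∄undominated = covering-[] λ w ¬dom → ∄undominated (w , ¬dom)
  ... | yes (t₀ , ¬dom₀) with any? (λ t → ¬? (Dominated? pos alice t) ×-dec ¬? (TwoFreeNeighbours? pos t))
  ...   | no ∄few = ⊥-elim (some-undominated-vertex-has-few-free-neighbours inv ¬dom₀ λ {v} ¬dom →
                        decidable-stable (TwoFreeNeighbours? pos v) λ ¬two → ∄few (v , ¬dom , ¬two))
  ...   | yes (t , ¬dom , ¬two) with any? (FreeNeighbour? pos t)
  ...     | no ∄free = ⊥-elim (Blocked⇒¬AliceWinsFrom (Guarded⇒Blocked guarded) (bob-move win t-free))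
    where
    t-free : Free pos t
    t-free = Invariant.undominated-free inv ¬dom
    guarded : Guarded pos t
    guarded {u} ut = owned-by-bob (λ u-free → ∄free (u , Adj-sym ut , u-free))
                                  (λ u-alice → ¬dom (u , u-alice , inj₂ ut))
  ...     | yes (y , ty , y-free) = respond (proj₂ (reply y y-free))
    where
    open Forcing inv ¬dom ty y-free (¬two⇒unique-free-neighbour ¬two (ty , y-free))
    respond : AliceWinsFrom G after-bob → CoveringFreeMatching pos
    respond (winNow x x-free dom) with x ≟ t
    ... | yes refl = extend-matching (covering-[] λ w ¬dom → ¬dom (dom w))
    ... | no  x≢t  = ⊥-elim (must-take-guarded t-free′ guarded x-free x≢t (inj₁ dom))
    respond (moveOn x x-free win′) with x ≟ t
    ... | yes refl = extend-matching (extract invariant win′)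
    ... | no  x≢t  = ⊥-elim (must-take-guarded t-free′ guarded x-free x≢t (inj₂ win′))

  extract-by : ∀ {pos x} → Invariant (claim G pos x alice) → AliceWinsBy pos x →
               CoveringFreeMatching (claim G pos x alice)
  extract-by _   (inj₁ dom) = covering-[] λ w ¬dom → ¬dom (dom w)
  extract-by inv (inj₂ win) = extract inv win

CoveringMatchingMinus : ∀ {n} → SimpleGraph n → Fin n → Set
CoveringMatchingMinus {n} G c =
  ∃ λ (M : List (Fin n × Fin n)) → IsMatchingMinus G c M × CoversOutsideClosedNbhd G c M

module Cherry {n : ℕ} (G : SimpleGraph n) (c : Fin n) where
  open Graph G
  open Game G

  leaf-neighbour : ∀ {l u} → IsLeaf G l → Adj G c l → Adj G u l → u ≡ c
  leaf-neighbour leaf cl ul = leaf-neighbour-unique leaf (Adj-sym ul) (Adj-sym cl)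

  closed-nbhd-of-leaf : ∀ {l w} → IsLeaf G l → Adj G c l → InClosedNbhd G l w → w ≡ l ⊎ w ≡ c
  closed-nbhd-of-leaf leaf cl (inj₁ refl) = inj₁ refl
  closed-nbhd-of-leaf leaf cl (inj₂ lw)   = inj₂ (leaf-neighbour leaf cl (Adj-sym lw))

  leaf-owned-by-dominator : ∀ {pos p l} → IsLeaf G l → Adj G c l → pos c ≢ own p → Dominated pos p l →
                            pos l ≡ own p
  leaf-owned-by-dominator _    _  _       (_ , u-owned , inj₁ refl) = u-owned
  leaf-owned-by-dominator leaf cl c-not-p (_ , u-owned , inj₂ ul) with refl ← leaf-neighbour leaf cl ul =
    ⊥-elim (c-not-p u-owned)

module Forward {n : ℕ} (G : SimpleGraph n) (forest : IsForest G) (c : Fin n) where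
  open Graph G
  open Forest forest
  open Game G
  open Extraction G forest
  open Cherry G c

  covering⇒matching : ∀ {pos} → ¬ Free pos c → (∀ {w} → Dominated pos alice w → InClosedNbhd G c w) →
                      CoveringFreeMatching pos → CoveringMatchingMinus G c
  covering⇒matching ¬free-c dom⇒near (M , matching , frees , covers) =
    M , (matching , λ c∈M → ¬free-c (All.lookup frees c∈M)) , λ w far → covers w (far ∘ dom⇒near)

  opening : Fin n → Pos
  opening v = claim G (start G) v alice

  dominated-by-opening : ∀ {v w} → Dominated (opening v) alice w → InClosedNbhd G v w
  dominated-by-opening dom with Dominated-claim⁻ {start G} dom
  ... | inj₁ (_ , () , _)
  ... | inj₂ (_ , vw) = vw

  near-centre : ∀ {w} → Free (opening c) w → Dominated (opening c) alice w → Adj G c w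
  near-centre w-free dom with dominated-by-opening dom
  ... | inj₁ refl = ⊥-elim (claimed-¬free (start G) c alice w-free)
  ... | inj₂ cw   = cw

  centre-invariant : Invariant (opening c)
  centre-invariant = record { undominated-free = undominated-free ; separated = separated }
    where
    undominated-free : ∀ {w} → ¬ Dominated (opening c) alice w → Free (opening c) w
    undominated-free {w} ¬dom = claim-free⁺ (start G) c alice w≢c refl
      where
      w≢c : w ≢ c
      w≢c refl = ¬dom (c , claim-≡ (start G) c alice , inj₁ refl)
    separated : ∀ {a b} xs → Path (Free (opening c)) (b ∷ xs ++ a ∷ []) →
                Dominated (opening c) alice a → Dominated (opening c) alice b → ⊥
    separated xs (unique , linked , frees@(b-free ∷ rest)) dom-a dom-b =
      path-ends-nonadjacent xs (¬Free⇒All≢ (claimed-¬free (start G) c alice) frees ∷ unique)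
        (near-centre b-free dom-b ∷ linked) (Adj-sym (near-centre (All.head (++⁻ʳ xs rest)) dom-a))

  opening-centre : AliceWinsBy (start G) c → CoveringMatchingMinus G c
  opening-centre win =
    covering⇒matching (claimed-¬free (start G) c alice) dominated-by-opening (extract-by centre-invariant win)

  reply-centre : Fin n → Pos
  reply-centre v = claim G (opening v) c bob

  module LeafOpening {l l′} (l≢l′ : l ≢ l′) (leaf : IsLeaf G l) (leaf′ : IsLeaf G l′)
                     (cl : Adj G c l) (cl′ : Adj G c l′) where

    after-l′ : Pos
    after-l′ = claim G (reply-centre l) l′ alice

    c-free : Free (opening l) c
    c-free = claim-free⁺ (start G) l alice (Adj⇒≢ cl) refl

    l′-free : Free (reply-centre l) l′
    l′-free = claim-free⁺ (opening l) c bob (≢-sym (Adj⇒≢ cl′)) (claim-free⁺ (start G) l alice (≢-sym l≢l′) refl)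

    NearLeaves : Fin n → Set
    NearLeaves w = InClosedNbhd G l w ⊎ InClosedNbhd G l′ w

    near-leaves : ∀ {w} → NearLeaves w → (w ≡ l ⊎ w ≡ l′) ⊎ w ≡ c
    near-leaves (inj₁ lw) with closed-nbhd-of-leaf leaf cl lw
    ... | inj₁ w≡l = inj₁ (inj₁ w≡l)
    ... | inj₂ w≡c = inj₂ w≡c
    near-leaves (inj₂ l′w) with closed-nbhd-of-leaf leaf′ cl′ l′w
    ... | inj₁ w≡l′ = inj₁ (inj₂ w≡l′)
    ... | inj₂ w≡c  = inj₂ w≡c

    dominated⇒near : ∀ {w} → Dominated after-l′ alice w → NearLeaves w
    dominated⇒near dom with Dominated-claim⁻ {reply-centre l} dom
    ... | inj₂ (_ , l′w) = inj₂ l′w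
    ... | inj₁ dom′ with Dominated-claim⁻ {opening l} dom′
    ...   | inj₁ dom″   = inj₁ (dominated-by-opening dom″)
    ...   | inj₂ (() , _)

    near⇒centre : ∀ {w} → NearLeaves w → InClosedNbhd G c w
    near⇒centre near with near-leaves near
    ... | inj₁ (inj₁ refl) = inj₂ cl
    ... | inj₁ (inj₂ refl) = inj₂ cl′
    ... | inj₂ refl        = inj₁ refl

    near⇒¬free : ∀ {w} → NearLeaves w → ¬ Free after-l′ w
    near⇒¬free near w-free with near-leaves near
    ... | inj₁ (inj₁ refl) = claimed-¬free (start G) l alice
                               (claim-free⁻ (opening l) c bob {l} (claim-free⁻ (reply-centre l) l′ alice {l} w-free))
    ... | inj₁ (inj₂ refl) = claimed-¬free (reply-centre l) l′ alice w-free
    ... | inj₂ refl        = claimed-¬free (opening l) c bob (claim-free⁻ (reply-centre l) l′ alice {c} w-free)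

    invariant : Invariant after-l′
    invariant = record { undominated-free = undominated-free ; separated = separated }
      where
      l-alice : after-l′ l ≡ own alice
      l-alice = claim-owned l l′-free (claim-owned l c-free (claim-≡ (start G) l alice))
      l′-alice : after-l′ l′ ≡ own alice
      l′-alice = claim-≡ (reply-centre l) l′ alice
      undominated-free : ∀ {w} → ¬ Dominated after-l′ alice w → Free after-l′ w
      undominated-free {w} ¬dom =
        claim-free⁺ (reply-centre l) l′ alice w≢l′
          (claim-free⁺ (opening l) c bob w≢c (claim-free⁺ (start G) l alice w≢l refl))
        where
        w≢l : w ≢ l
        w≢l refl = ¬dom (l , l-alice , inj₁ refl)
        w≢l′ : w ≢ l′
        w≢l′ refl = ¬dom (l′ , l′-alice , inj₁ refl)
        w≢c : w ≢ c
        w≢c refl = ¬dom (l , l-alice , inj₂ (Adj-sym cl))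
      separated : ∀ {a b} xs → Path (Free after-l′) (b ∷ xs ++ a ∷ []) →
                  Dominated after-l′ alice a → Dominated after-l′ alice b → ⊥
      separated _ (_ , _ , b-free ∷ _) _ dom-b = near⇒¬free (dominated⇒near dom-b) b-free

    opening-leaf : AliceWinsBy (reply-centre l) l′ → CoveringMatchingMinus G c
    opening-leaf win =
      covering⇒matching (near⇒¬free (inj₁ (inj₂ (Adj-sym cl)))) (near⇒centre ∘ dominated⇒near)
        (extract-by invariant win)

  leaf-reply : ∀ {v x l} → IsLeaf G l → Adj G c l → l ≢ v →
               Free (reply-centre v) x → AliceWinsBy (reply-centre v) x → x ≡ l
  leaf-reply {v} {x} {l} leaf cl l≢v x-free win with x ≟ l
  ... | yes x≡l = x≡l
  ... | no  x≢l = ⊥-elim (must-take-guarded l-free guarded x-free x≢l win)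
    where
    l-free : Free (reply-centre v) l
    l-free = claim-free⁺ (opening v) c bob (≢-sym (Adj⇒≢ cl)) (claim-free⁺ (start G) v alice l≢v refl)
    guarded : Guarded (reply-centre v) l
    guarded ul with refl ← leaf-neighbour leaf cl ul = claim-≡ (opening v) c bob

  opening-elsewhere : ∀ {v l₁ l₂} → IsCherry G c l₁ l₂ → v ≢ c → AliceWinsBy (start G) v →
                      CoveringMatchingMinus G c
  opening-elsewhere {v} (l₁≢l₂ , leaf₁ , leaf₂ , cl₁ , cl₂) v≢c (inj₁ dom) =
    ⊥-elim (l₁≢l₂ (≡.trans (≡.sym (beside leaf₁ cl₁)) (beside leaf₂ cl₂)))
    where
    beside : ∀ {l} → IsLeaf G l → Adj G c l → v ≡ l
    beside leaf cl with closed-nbhd-of-leaf leaf cl (InClosedNbhd-sym (dominated-by-opening (dom _)))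
    ... | inj₁ v≡l = v≡l
    ... | inj₂ v≡c = ⊥-elim (v≢c v≡c)
  opening-elsewhere {v} {l₁} {l₂} (l₁≢l₂ , leaf₁ , leaf₂ , cl₁ , cl₂) v≢c (inj₂ win)
    with x , x-free , win-x ← alice-move (bob-move win (claim-free⁺ (start G) v alice (≢-sym v≢c) refl))
    with v ≟ l₁ | v ≟ l₂
  ... | yes refl | _ =
    LeafOpening.opening-leaf l₁≢l₂ leaf₁ leaf₂ cl₁ cl₂
      (subst (AliceWinsBy (reply-centre v)) (leaf-reply leaf₂ cl₂ (≢-sym l₁≢l₂) x-free win-x) win-x)
  ... | no _ | yes refl =
    LeafOpening.opening-leaf (≢-sym l₁≢l₂) leaf₂ leaf₁ cl₂ cl₁
      (subst (AliceWinsBy (reply-centre v)) (leaf-reply leaf₁ cl₁ l₁≢l₂ x-free win-x) win-x)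
  ... | no v≢l₁ | no v≢l₂ =
    ⊥-elim (l₁≢l₂ (≡.trans (≡.sym (leaf-reply leaf₁ cl₁ (≢-sym v≢l₁) x-free win-x))
                           (leaf-reply leaf₂ cl₂ (≢-sym v≢l₂) x-free win-x)))

  alice-wins⇒matching : ∀ {l₁ l₂} → IsCherry G c l₁ l₂ → AliceWins G → CoveringMatchingMinus G c
  alice-wins⇒matching cherry win with v , _ , win-v ← alice-move win with v ≟ c
  ... | yes refl = opening-centre win-v
  ... | no  v≢c  = opening-elsewhere cherry v≢c win-v

module Pairs {n : ℕ} (G : SimpleGraph n) where

  ∈⇒endpoints : ∀ {Q a b} → (a , b) ∈ Q → a ∈ endpoints G Q × b ∈ endpoints G Q
  ∈⇒endpoints (here refl) = here refl , there (here refl)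
  ∈⇒endpoints (there ab∈) with a∈ , b∈ ← ∈⇒endpoints ab∈ = there (there a∈) , there (there b∈)

  Mate : List (Fin n × Fin n) → Fin n → Fin n → Set
  Mate Q a b = (a , b) ∈ Q ⊎ (b , a) ∈ Q

  Mate? : ∀ Q a b → Dec (Mate Q a b)
  Mate? Q a b = ((a , b) ∈? Q) ⊎-dec ((b , a) ∈? Q)
    where open DecMembership (≡-dec _≟_ _≟_) using (_∈?_)

  mate-sym : ∀ {Q a b} → Mate Q a b → Mate Q b a
  mate-sym (inj₁ ab) = inj₂ ab
  mate-sym (inj₂ ba) = inj₁ ba

  mate⇒endpoint : ∀ {Q a b} → Mate Q a b → a ∈ endpoints G Q
  mate⇒endpoint (inj₁ ab) = proj₁ (∈⇒endpoints ab)
  mate⇒endpoint (inj₂ ba) = proj₂ (∈⇒endpoints ba)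

  endpoint⇒mate : ∀ {Q a} → a ∈ endpoints G Q → ∃ (Mate Q a)
  endpoint⇒mate {(x , y) ∷ Q} (here refl)         = y , inj₁ (here refl)
  endpoint⇒mate {(x , y) ∷ Q} (there (here refl)) = x , inj₂ (here refl)
  endpoint⇒mate {(x , y) ∷ Q} (there (there a∈)) with b , m ← endpoint⇒mate a∈ with m
  ... | inj₁ ab = b , inj₁ (there ab)
  ... | inj₂ ba = b , inj₂ (there ba)

  ∉endpoints⇒≢ : ∀ {Q a b v} → All (v ≢_) (endpoints G Q) → (a , b) ∈ Q → a ≢ v × b ≢ v
  ∉endpoints⇒≢ v∉ ab∈ with a∈ , b∈ ← ∈⇒endpoints ab∈ =
    (λ { refl → All.lookup v∉ a∈ refl }) , (λ { refl → All.lookup v∉ b∈ refl })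

  first-functional : ∀ {Q a b b′} → Unique (endpoints G Q) → (a , b) ∈ Q → (a , b′) ∈ Q → b ≡ b′
  first-functional _               (here refl) (here refl)  = refl
  first-functional ((_ ∷ x∉) ∷ _) (here refl) (there ab′∈) = ⊥-elim (proj₁ (∉endpoints⇒≢ x∉ ab′∈) refl)
  first-functional ((_ ∷ x∉) ∷ _) (there ab∈) (here refl)  = ⊥-elim (proj₁ (∉endpoints⇒≢ x∉ ab∈) refl)
  first-functional (_ ∷ _ ∷ u)    (there ab∈) (there ab′∈) = first-functional u ab∈ ab′∈

  second-functional : ∀ {Q a b b′} → Unique (endpoints G Q) → (b , a) ∈ Q → (b′ , a) ∈ Q → b ≡ b′
  second-functional _             (here refl) (here refl)  = refl
  second-functional (_ ∷ y∉ ∷ _) (here refl) (there ba∈)  = ⊥-elim (proj₂ (∉endpoints⇒≢ y∉ ba∈) refl)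
  second-functional (_ ∷ y∉ ∷ _) (there ba∈) (here refl)  = ⊥-elim (proj₂ (∉endpoints⇒≢ y∉ ba∈) refl)
  second-functional (_ ∷ _ ∷ u)  (there ba∈) (there ba′∈) = second-functional u ba∈ ba′∈

  first≢second : ∀ {Q a b b′} → Unique (endpoints G Q) → (a , b) ∈ Q → (b′ , a) ∈ Q → ⊥
  first≢second ((x≢y ∷ _) ∷ _) (here refl) (here refl) = x≢y refl
  first≢second ((_ ∷ x∉) ∷ _)  (here refl) (there ba∈) = proj₂ (∉endpoints⇒≢ x∉ ba∈) refl
  first≢second (_ ∷ y∉ ∷ _)    (there ab∈) (here refl) = proj₁ (∉endpoints⇒≢ y∉ ab∈) refl
  first≢second (_ ∷ _ ∷ u)     (there ab∈) (there ba∈) = first≢second u ab∈ ba∈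

  mate-functional : ∀ {Q a b b′} → Unique (endpoints G Q) → Mate Q a b → Mate Q a b′ → b ≡ b′
  mate-functional u (inj₁ ab) (inj₁ ab′) = first-functional u ab ab′
  mate-functional u (inj₂ ba) (inj₂ b′a) = second-functional u ba b′a
  mate-functional u (inj₁ ab) (inj₂ b′a) = ⊥-elim (first≢second u ab b′a)
  mate-functional u (inj₂ ba) (inj₁ ab′) = ⊥-elim (first≢second u ab′ ba)

  mate-irrefl : ∀ {Q a b} → Unique (endpoints G Q) → Mate Q a b → a ≢ b
  mate-irrefl u (inj₁ ab) refl = first≢second u ab ab
  mate-irrefl u (inj₂ ba) refl = first≢second u ba ba

  AllEdges-∈ : ∀ {Q a b} → AllEdges G Q → (a , b) ∈ Q → Adj G a b
  AllEdges-∈ (ab , _)     (here refl) = ab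
  AllEdges-∈ (_ , edges) (there ab∈) = AllEdges-∈ edges ab∈

module Backward {n : ℕ} (G : SimpleGraph n) (c : Fin n)
                {l₁ l₂ : Fin n} (l₁≢l₂ : l₁ ≢ l₂) (leaf₁ : IsLeaf G l₁) (leaf₂ : IsLeaf G l₂)
                (cl₁ : Adj G c l₁) (cl₂ : Adj G c l₂)
                {M : List (Fin n × Fin n)} (M-edges : AllEdges G M) (M-unique : Unique (endpoints G M))
                (c∉M : c ∉ endpoints G M) (covers : CoversOutsideClosedNbhd G c M) where
  open Graph G
  open Game G
  open Pairs G
  open Cherry G c

  mate-adjacent : ∀ {a b} → Mate M a b → Adj G a b
  mate-adjacent (inj₁ ab) = AllEdges-∈ M-edges ab
  mate-adjacent (inj₂ ba) = Adj-sym (AllEdges-∈ M-edges ba)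

  leaf∉M : ∀ {l} → IsLeaf G l → Adj G c l → l ∉ endpoints G M
  leaf∉M leaf cl l∈M with b , m ← endpoint⇒mate l∈M with refl ← leaf-neighbour leaf cl (Adj-sym (mate-adjacent m)) =
    c∉M (mate⇒endpoint (mate-sym m))

  pairs : List (Fin n × Fin n)
  pairs = (l₁ , l₂) ∷ M

  pairs-unique : Unique (endpoints G pairs)
  pairs-unique = (l₁≢l₂ ∷ ¬Any⇒All¬ _ (leaf∉M leaf₁ cl₁)) ∷ ¬Any⇒All¬ _ (leaf∉M leaf₂ cl₂) ∷ M-unique

  c∉pairs : c ∉ endpoints G pairs
  c∉pairs (here refl)         = Adj⇒≢ cl₁ refl
  c∉pairs (there (here refl)) = Adj⇒≢ cl₂ refl
  c∉pairs (there (there c∈M)) = c∉M c∈M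

  near-or-mated : ∀ w → InClosedNbhd G c w ⊎ ∃ λ b → Mate pairs w b × Adj G w b
  near-or-mated w with (c ≟ w) ⊎-dec Adj? c w
  ... | yes near = inj₁ near
  ... | no  far with b , m ← endpoint⇒mate (covers w far) =
    inj₂ (b , Sum.map there there m , mate-adjacent m)

  PairClaimed : Pos → Fin n → Fin n → Set
  PairClaimed pos a b = (Free pos a × Free pos b) ⊎ (pos a ≡ own alice ⊎ pos b ≡ own alice)

  record Paired (pos : Pos) : Set where
    field
      centre  : pos c ≡ own alice
      claimed : ∀ {a b} → Mate pairs a b → PairClaimed pos a b
  open Paired

  paired-dominates : ∀ {pos} → Paired pos → (∀ {a b} → Mate pairs a b → ¬ (Free pos a × Free pos b)) →
                     Dominates G pos alice
  paired-dominates paired ¬both w with near-or-mated w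
  ... | inj₁ cw = c , centre paired , cw
  ... | inj₂ (b , m , wb) with claimed paired m
  ...   | inj₁ both             = ⊥-elim (¬both m both)
  ...   | inj₂ (inj₁ w-alice)   = w , w-alice , inj₁ refl
  ...   | inj₂ (inj₂ b-alice)   = b , b-alice , inj₂ (Adj-sym wb)

  bob-cannot-dominate : ∀ {pos w} → Paired pos → Free pos w → ¬ Dominates G (claim G pos w bob) bob
  bob-cannot-dominate {pos} {w} paired w-free dom = leaves-unclaimable (claimed paired (inj₁ (here refl)))
    where
    c-alice : claim G pos w bob c ≡ own alice
    c-alice = claim-owned c w-free (centre paired)
    bob-leaf : ∀ {l} → IsLeaf G l → Adj G c l → claim G pos w bob l ≡ own bob
    bob-leaf leaf cl = leaf-owned-by-dominator leaf cl (λ c-bob → case ≡.trans (≡.sym c-alice) c-bob of λ ()) (dom _)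
    taken-now : ∀ {l} → IsLeaf G l → Adj G c l → Free pos l → l ≡ w
    taken-now leaf cl l-free with claim-cases pos w bob (bob-leaf leaf cl)
    ... | inj₁ (l≡w , _) = l≡w
    ... | inj₂ l-bob = case ≡.trans (≡.sym l-free) l-bob of λ ()
    not-alice : ∀ {l} → IsLeaf G l → Adj G c l → pos l ≢ own alice
    not-alice {l} leaf cl l-alice = case ≡.trans (≡.sym (claim-owned l w-free l-alice)) (bob-leaf leaf cl) of λ ()
    leaves-unclaimable : ¬ PairClaimed pos l₁ l₂
    leaves-unclaimable (inj₁ (l₁-free , l₂-free)) =
      l₁≢l₂ (≡.trans (taken-now leaf₁ cl₁ l₁-free) (≡.sym (taken-now leaf₂ cl₂ l₂-free)))
    leaves-unclaimable (inj₂ (inj₁ l₁-alice)) = not-alice leaf₁ cl₁ l₁-alice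
    leaves-unclaimable (inj₂ (inj₂ l₂-alice)) = not-alice leaf₂ cl₂ l₂-alice

  PairingReply : Pos → Fin n → Fin n → Set
  PairingReply pos w z = Free (claim G pos w bob) z × (∀ {b} → Mate pairs w b → Free (claim G pos w bob) b → z ≡ b)

  pairing-reply : ∀ {pos w} → Paired pos → ¬ Dominates G pos alice → Free pos w → ∃ (PairingReply pos w)
  pairing-reply {pos} {w} paired ¬dom w-free with any? (λ z → Mate? pairs w z ×-dec Free? (claim G pos w bob) z)
  ... | yes (z , m , z-free) = z , z-free , λ m′ _ → mate-functional pairs-unique m m′
  ... | no  ∄free-mate with any? (Free? (claim G pos w bob))
  ...   | yes (z , z-free) = z , z-free , λ m b-free → ⊥-elim (∄free-mate (_ , m , b-free))
  ...   | no  ∄free = ⊥-elim (¬dom (paired-dominates paired ¬both))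
    where
    ¬both : ∀ {a b} → Mate pairs a b → ¬ (Free pos a × Free pos b)
    ¬both {a} {b} m (a-free , b-free) with a ≟ w
    ... | yes refl = ∄free (b , claim-free⁺ pos a bob (mate-irrefl pairs-unique (mate-sym m)) b-free)
    ... | no  a≢w  = ∄free (a , claim-free⁺ pos w bob a≢w a-free)

  paired-round : ∀ {pos w z} → Paired pos → Free pos w → PairingReply pos w z →
                 Paired (claim G (claim G pos w bob) z alice)
  paired-round {pos} {w} {z} paired w-free (z-free , z-rule) = record { centre = keep (centre paired) ; claimed = claimed′ }
    where
    after-bob : Pos
    after-bob = claim G pos w bob
    keep : ∀ {u} → pos u ≡ own alice → claim G after-bob z alice u ≡ own alice
    keep {u} u-alice = claim-owned u z-free (claim-owned u w-free u-alice)
    alice-z : ∀ {u} → z ≡ u → claim G after-bob z alice u ≡ own alice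
    alice-z refl = claim-≡ after-bob z alice
    unaffected : ∀ {a b} → Free after-bob a → Free after-bob b → PairClaimed (claim G after-bob z alice) a b
    unaffected {a} {b} a-free b-free with z ≟ a | z ≟ b
    ... | yes z≡a | _       = inj₂ (inj₁ (alice-z z≡a))
    ... | no  _   | yes z≡b = inj₂ (inj₂ (alice-z z≡b))
    ... | no  z≢a | no  z≢b = inj₁ (claim-free⁺ after-bob z alice (≢-sym z≢a) a-free ,
                                    claim-free⁺ after-bob z alice (≢-sym z≢b) b-free)
    both-free : ∀ {a b} → Mate pairs a b → Free pos a → Free pos b → Dec (a ≡ w) → Dec (b ≡ w) →
                PairClaimed (claim G after-bob z alice) a b
    both-free {a} m _ b-free (yes refl) _ =
      inj₂ (inj₂ (alice-z (z-rule m (claim-free⁺ pos a bob (mate-irrefl pairs-unique (mate-sym m)) b-free))))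
    both-free {b = b} m a-free _ (no a≢w) (yes refl) =
      inj₂ (inj₁ (alice-z (z-rule (mate-sym m) (claim-free⁺ pos b bob a≢w a-free))))
    both-free m a-free b-free (no a≢w) (no b≢w) =
      unaffected (claim-free⁺ pos w bob a≢w a-free) (claim-free⁺ pos w bob b≢w b-free)
    claimed′ : ∀ {a b} → Mate pairs a b → PairClaimed (claim G after-bob z alice) a b
    claimed′ {a} {b} m with claimed paired m
    ... | inj₁ (a-free , b-free) = both-free m a-free b-free (a ≟ w) (b ≟ w)
    ... | inj₂ (inj₁ a-alice)    = inj₂ (inj₁ (keep a-alice))
    ... | inj₂ (inj₂ b-alice)    = inj₂ (inj₂ (keep b-alice))

  strategy : ∀ k {pos} → freeCount pos < k → Paired pos → ¬ Dominates G pos alice → AliceWinsAfter G pos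
  strategy zero    ()
  strategy (suc k) {pos} bound paired ¬dom with any? (Free? pos)
  ... | no  ∄free   = ⊥-elim (¬dom (paired-dominates paired λ _ (a-free , _) → ∄free (_ , a-free)))
  ... | yes some-free = bobMoves some-free λ w w-free →
        bob-cannot-dominate paired w-free , answer w-free (proj₂ (pairing-reply paired ¬dom w-free))
    where
    answer : ∀ {w z} → Free pos w → PairingReply pos w z → AliceWinsFrom G (claim G pos w bob)
    answer {w} {z} w-free reply@(z-free , _) with all? (Dominated? (claim G (claim G pos w bob) z alice) alice)
    ... | yes dom  = winNow z z-free dom
    ... | no  ¬dom′ = moveOn z z-free (strategy k bound′ (paired-round paired w-free reply) ¬dom′)
      where
      bound′ : freeCount (claim G (claim G pos w bob) z alice) < k
      bound′ = <-trans (freeCount-claim alice z-free) (<-≤-trans (freeCount-claim bob w-free) (≤-pred bound))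

  opening : Pos
  opening = claim G (start G) c alice

  opening-paired : Paired opening
  opening-paired = record
    { centre  = claim-≡ (start G) c alice
    ; claimed = λ m → inj₁ (mated-free m , mated-free (mate-sym m))
    }
    where
    mated-free : ∀ {a b} → Mate pairs a b → Free opening a
    mated-free {a} m = claim-free⁺ (start G) c alice {a} (λ { refl → c∉pairs (mate⇒endpoint m) }) refl

  matching⇒alice-wins : AliceWins G
  matching⇒alice-wins with all? (Dominated? opening alice)
  ... | yes dom  = winNow c refl dom
  ... | no  ¬dom = moveOn c refl (strategy (suc (freeCount opening)) ≤-refl opening-paired ¬dom)

lemma20 : (n : ℕ) (F : SimpleGraph n) → IsForest F →
          (c l₁ l₂ : Fin n) → HasUniqueCherry F c l₁ l₂ →
          AliceWins F ⇔ (∃ λ (M : List (Fin n × Fin n)) →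
                           IsMatchingMinus F c M × CoversOutsideClosedNbhd F c M)
lemma20 n F forest c l₁ l₂ (cherry@(l₁≢l₂ , leaf₁ , leaf₂ , cl₁ , cl₂) , _) =
  mk⇔ (Forward.alice-wins⇒matching F forest c cherry)
      λ { (M , ((M-edges , M-unique) , c∉M) , covers) →
          Backward.matching⇒alice-wins F c l₁≢l₂ leaf₁ leaf₂ cl₁ cl₂ M-edges M-unique c∉M covers }
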